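{- Let $\mathcal{G}$ be a concurrent game structure and $Z=(\chi,\mathrm{I},\rho)$ a state with a fully informed information perspective $\mathrm{I}$. Then for every agent $a$ and every formula $\phi$ of $\mathcal{L}^{\mathsf C}$, $\mathcal{G},Z\Vdash\lnot\mathsf{K}_a\phi\to\mathsf{K}_a\lnot\mathsf{K}_a\phi$.
   Context: Fix a countable set $\mathsf{Prop}$ of atomic propositions and a finite set $\mathsf{Ag}$ of agents. A concurrent game structure is a tuple $\mathcal{G}=(\mathsf{Ac},\mathsf{V},\mathsf{E},\ell,(\sim_a)_{a\in\mathsf{Ag}})$ where $\mathsf{Ac}$ is a finite set of actions, $\mathsf{V}$ is a finite set of positions, $\mathsf{E}:\mathsf{V}\times\mathsf{Ac}^{\mathsf{Ag}}\to\mathsf{V}$ is a transition function, $\ell:\mathsf{V}\to\mathcal{P}(\mathsf{Prop})$ is a valuation, and for each agent $a$, $\sim_a\subseteq(\mathsf{V}\times\mathsf{V})\cup(\mathsf{Ac}\times\mathsf{Ac})$ is an equivalence relation. A joint action is a function $\alpha:\mathsf{Ag}\to\mathsf{Ac}$; $\alpha\sim_a\beta$ iff $\alpha(b)\sim_a\beta(b)$ for all $b$. A history is a sequence $\rho=v_0\alpha_1v_1\ldots\alpha_nv_n$ of positions and joint actions with $\mathsf{E}(v_i,\alpha_{i+1})=v_{i+1}$ for all $i<n$; $\rho_{\le i}=v_0\alpha_1\ldots\alpha_iv_i$, $\mathsf{last}(\rho)=v_n$; $\mathsf{Hist}$ is the set of histories. $\rho\sim_a\rho'$ for histories iff they have the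 same number $n$ of joint actions, their $i$-th positions are $\sim_a$-related for all $i\le n$ and their $i$-th joint actions are $\sim_a$-related for all $1\le i\le n$. A strategy is a function $\mathsf{Hist}\to\mathsf{Ac}$; an assignment is a function $\chi$ from $\mathsf{Ag}$ to strategies. $\rho$ is consistent with $\chi$ for $X\subseteq\mathsf{Ag}$ if $\alpha_{i+1}(b)=\chi(b)(\rho_{\le i})$ for all $i<n$, $b\in X$. The one-step continuation is $\mathsf{X}^\chi_{\mathcal G}\rho=v_0\alpha_1\ldots\alpha_nv_n\alpha_{n+1}v_{n+1}$ with $\alpha_{n+1}(b)=\chi(b)(\rho)$ for all $b$ and $v_{n+1}=\mathsf{E}(v_n,\alpha_{n+1})$. $\mathsf{Ag}^*$ is the set of finite words over $\mathsf{Ag}$ with no two equal adjacent letters; $\mathsf{Ag}^{\ge n}$ those of length $\ge n$; $aw$ denotes $w$ prefixed by $a$. An information perspective is a set $\mathrm{I}\subseteq\mathsf{Ag}^{\ge2}$; it is fully informed if $\mathrm{I}=\mathsf{Ag}^{\ge2}$. $\mathrm{I}_a=\{b: ab\in\mathrm{I}\}\cup\{a\}$; $\mathrm{I}[a]=\{w\in\mathsf{Ag}^{\ge2}: aw\in\mathrm{I}\}\cup\{w\in\mathrm{I}: w=aw'\text{ for some }w'\in\mathsf{Ag}^*\}$. $\chi\sim^{\mathrm{I}}_a\chi'$ iff $\chi(b)=\chi'(b)$ for all $b\in\mathrm{I}_a$. A state is a triple $(\chi,\mathrm{I},\rho)$ (assignment, information perspective, history); it is $a$-consistent if $\rho$ is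 consistent with $\chi$ for $\mathrm{I}_a$. $(\chi,\mathrm{I},\rho)\trianglelefteq_a(\chi',\mathrm{I}',\rho')$ iff $\chi\sim^{\mathrm{I}}_a\chi'$, $\mathrm{I}[a]\subseteq\mathrm{I}'$, $\rho\sim_a\rho'$, and both states are $a$-consistent. For $G\subseteq\mathsf{Ag}$, $Z\trianglelefteq_GZ'$ iff $Z\trianglelefteq_aZ'$ for some $a\in G$, and $\trianglelefteq^*_G$ is the transitive closure of $\trianglelefteq_G$. Formulas of $\mathcal{L}^{\mathsf C}$: $\phi::=p\mid\bot\mid\phi\to\phi\mid\mathsf{K}_a\phi\mid\mathsf{C}_G\phi\mid\mathsf{X}\phi$ with $p\in\mathsf{Prop}$, $a\in\mathsf{Ag}$, $G\subseteq\mathsf{Ag}$ ($\lnot\phi$ is $\phi\to\bot$). Truth at $Z=(\chi,\mathrm{I},\rho)$: $\mathcal{G},Z\Vdash p$ iff $p\in\ell(\mathsf{last}(\rho))$; $\bot$ is never true; $\to$ is classical; $\mathcal{G},Z\Vdash\mathsf{K}_a\phi$ iff $\mathcal{G},Z'\Vdash\phi$ for all $Z'$ with $Z\trianglelefteq_aZ'$; $\mathcal{G},Z\Vdash\mathsf{C}_G\phi$ iff $\mathcal{G},Z'\Vdash\phi$ for all $Z'$ with $Z\trianglelefteq^*_GZ'$; $\mathcal{G},Z\Vdash\mathsf{X}\phi$ iff $\mathcal{G},(\chi,\mathrm{I},\mathsf{X}^\chi_{\mathcal G}\rho)\Vdash\phi$. -}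

module Defs where

open import Level using (Level; 0ℓ; Lift; lift) renaming (suc to lsuc)
open import Data.Nat using (ℕ; _≥_)
open import Data.Fin using (Fin)
open import Data.Fin.Subset using (Subset) renaming (_∈_ to _∈ₛ_)
open import Data.List using (List; []; _∷_; length)
open import Data.Product using (Σ; ∃; _×_; _,_)
open import Data.Sum using (_⊎_)
open import Data.Unit using (⊤)
open import Data.Empty using (⊥)
open import Relation.Nullary using (¬_)
open import Relation.Binary using (Rel; IsEquivalence)
open import Relation.Binary.PropositionalEquality using (_≡_)
open import Relation.Binary.Construct.Closure.Transitive using (TransClosure)

Agent : ℕ → Set
Agent n = Fin n

record CGS (n : ℕ) : Set₁ where
  field
    nAc   : ℕ
    nV    : ℕ
  Ac : Set
  Ac = Fin nAc
  V : Set
  V = Fin nV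
  JointAct : Set
  JointAct = Agent n → Ac
  field
    E     : V → JointAct → V
    ℓ     : V → ℕ → Set
    -- ∼ₐ ⊆ (V×V) ∪ (Ac×Ac), an equivalence relation: its two parts
    ∼V    : Agent n → Rel V 0ℓ
    ∼Ac   : Agent n → Rel Ac 0ℓ
    ∼V-equiv  : ∀ a → IsEquivalence (∼V a)
    ∼Ac-equiv : ∀ a → IsEquivalence (∼Ac a)

module _ {n : ℕ} (G : CGS n) where
  open CGS G

  _∼J[_]_ : JointAct → Agent n → JointAct → Set
  α ∼J[ a ] β = ∀ b → ∼Ac a (α b) (β b)

  -- Histories v₀ α₁ v₁ … αₙ vₙ with E(vᵢ,αᵢ₊₁)=vᵢ₊₁.  Since E is a function,
  -- such a history is determined by v₀ and α₁…αₙ; we build it in snoc form.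
  data Hist : Set where
    init : V → Hist
    _▷_  : Hist → JointAct → Hist

  last : Hist → V
  last (init v) = v
  last (h ▷ α)  = E (last h) α

  data _∼H[_]_ : Hist → Agent n → Hist → Set where
    init∼ : ∀ {a v v'} → ∼V a v v' → init v ∼H[ a ] init v'
    step∼ : ∀ {a h h' α α'} → h ∼H[ a ] h' → α ∼J[ a ] α' →
            ∼V a (E (last h) α) (E (last h') α') → (h ▷ α) ∼H[ a ] (h' ▷ α')

  Strategy : Set
  Strategy = Hist → Ac

  Assignment : Set
  Assignment = Agent n → Strategy

  Consistent : Assignment → (Agent n → Set) → Hist → Set
  Consistent χ X (init v) = ⊤
  Consistent χ X (h ▷ α)  = Consistent χ X h × (∀ b → X b → α b ≡ χ b h)

  next : Assignment → Hist → Hist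
  next χ ρ = ρ ▷ (λ b → χ b ρ)

NoAdj : ∀ {n} → List (Agent n) → Set
NoAdj []            = ⊤
NoAdj (x ∷ [])      = ⊤
NoAdj (x ∷ y ∷ w)   = ¬ (x ≡ y) × NoAdj (y ∷ w)

Ag≥2 : ∀ {n} → List (Agent n) → Set
Ag≥2 w = NoAdj w × length w ≥ 2

record InfoPersp (n : ℕ) : Set₁ where
  field
    mem : List (Agent n) → Set
    sub : ∀ w → mem w → Ag≥2 w

FullyInformed : ∀ {n} → InfoPersp n → Set
FullyInformed I = ∀ w → Ag≥2 w → InfoPersp.mem I w

I⟨_⟩ : ∀ {n} → InfoPersp n → Agent n → Agent n → Set
I⟨ I ⟩ a b = InfoPersp.mem I (a ∷ b ∷ []) ⊎ b ≡ a

I[_]_ : ∀ {n} → InfoPersp n → Agent n → List (Agent n) → Set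
(I[ I ] a) w = (Ag≥2 w × InfoPersp.mem I (a ∷ w))
             ⊎ (InfoPersp.mem I w × Σ (List _) (λ w' → w ≡ a ∷ w'))

module _ {n : ℕ} (G : CGS n) where
  open CGS G

  record State : Set₁ where
    constructor st
    field
      χ : Assignment G
      I : InfoPersp n
      ρ : Hist G

  _∼A⟨_⟩[_]_ : Assignment G → InfoPersp n → Agent n → Assignment G → Set
  χ ∼A⟨ I ⟩[ a ] χ' = ∀ b → I⟨ I ⟩ a b → ∀ h → χ b h ≡ χ' b h

  ConsistentState : Agent n → State → Set
  ConsistentState a (st χ I ρ) = Consistent G χ (I⟨ I ⟩ a) ρ

  _⊴[_]_ : State → Agent n → State → Set
  Z ⊴[ a ] Z' =
      (State.χ Z ∼A⟨ State.I Z ⟩[ a ] State.χ Z')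
    × (∀ w → (I[ State.I Z ] a) w → InfoPersp.mem (State.I Z') w)
    × (_∼H[_]_ G (State.ρ Z) a (State.ρ Z'))
    × ConsistentState a Z
    × ConsistentState a Z'

  _⊴G[_]_ : State → Subset n → State → Set
  Z ⊴G[ Gr ] Z' = Σ (Agent n) (λ a → (a ∈ₛ Gr) × (Z ⊴[ a ] Z'))

  _⊴G*[_]_ : State → Subset n → State → Set₁
  Z ⊴G*[ Gr ] Z' = TransClosure (λ X Y → X ⊴G[ Gr ] Y) Z Z'

data Form (n : ℕ) : Set where
  atom : ℕ → Form n
  ⊥f   : Form n
  _⇒_  : Form n → Form n → Form n
  K    : Agent n → Form n → Form n
  C    : Subset n → Form n → Form n
  X    : Form n → Form n

¬f : ∀ {n} → Form n → Form n
¬f φ = φ ⇒ ⊥f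

module _ {n : ℕ} (G : CGS n) where
  open CGS G

  _⊩_ : State G → Form n → Set₁
  Z ⊩ atom p  = Lift _ (ℓ (last G (State.ρ Z)) p)
  Z ⊩ ⊥f      = Lift _ ⊥
  Z ⊩ (φ ⇒ ψ) = Z ⊩ φ → Z ⊩ ψ
  Z ⊩ K a φ   = ∀ Z' → _⊴[_]_ G Z a Z' → Z' ⊩ φ
  Z ⊩ C Gr φ  = ∀ Z' → _⊴G*[_]_ G Z Gr Z' → Z' ⊩ φ
  Z ⊩ X φ     = st (State.χ Z) (State.I Z) (next G (State.χ Z) (State.ρ Z)) ⊩ φ

-- Under full information Z's perspective relates a to every agent and contains
-- every word of Ag≥2, so Z ⊴ₐ Z₁ and Z ⊴ₐ Z' force χ₁ and χ' to coincide with χ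
-- and I' to contain all of Ag≥2 ⊇ I₁[a]. With ∼ₐ an equivalence on histories,
-- ⊴ₐ is therefore Euclidean at Z, and Euclidean accessibility validates the
-- negative introspection axiom ¬Kₐφ → Kₐ¬Kₐφ.
module Submission where

open import Defs
open import Data.Nat using (ℕ; s≤s; z≤n)
open import Data.Fin using (_≟_)
open import Data.List using ([]; _∷_)
open import Data.Product using (_,_)
open import Data.Sum using (inj₁; inj₂)
open import Data.Unit using (tt)
open import Relation.Nullary using (yes; no)
open import Relation.Binary using (IsEquivalence)
open import Relation.Binary.PropositionalEquality using (refl; sym; trans; ≢-sym)

module _ {n : ℕ} (G : CGS n) where
  open CGS G

  ∼H-sym : ∀ {a h h'} → _∼H[_]_ G h a h' → _∼H[_]_ G h' a h
  ∼H-sym {a} (init∼ v∼v') = init∼ (IsEquivalence.sym (∼V-equiv a) v∼v')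
  ∼H-sym {a} (step∼ h∼h' α∼α' v∼v') =
    step∼ (∼H-sym h∼h')
          (λ b → IsEquivalence.sym (∼Ac-equiv a) (α∼α' b))
          (IsEquivalence.sym (∼V-equiv a) v∼v')

  ∼H-trans : ∀ {a h h' h''} → _∼H[_]_ G h a h' → _∼H[_]_ G h' a h'' → _∼H[_]_ G h a h''
  ∼H-trans {a} (init∼ v∼v') (init∼ v'∼v'') = init∼ (IsEquivalence.trans (∼V-equiv a) v∼v' v'∼v'')
  ∼H-trans {a} (step∼ h∼h' α∼α' v∼v') (step∼ h'∼h'' α'∼α'' v'∼v'') =
    step∼ (∼H-trans h∼h' h'∼h'')
          (λ b → IsEquivalence.trans (∼Ac-equiv a) (α∼α' b) (α'∼α'' b))
          (IsEquivalence.trans (∼V-equiv a) v∼v' v'∼v'')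

I[]⊆Ag≥2 : ∀ {n} (I : InfoPersp n) a w → (I[ I ] a) w → Ag≥2 w
I[]⊆Ag≥2 I a w (inj₁ (w∈Ag≥2 , _)) = w∈Ag≥2
I[]⊆Ag≥2 I a w (inj₂ (w∈I , _))    = InfoPersp.sub I w w∈I

fullyInformed⇒I⟨⟩ : ∀ {n} (I : InfoPersp n) → FullyInformed I → ∀ a b → I⟨ I ⟩ a b
fullyInformed⇒I⟨⟩ I full a b with b ≟ a
... | yes b≡a = inj₂ b≡a
... | no b≢a  = inj₁ (full (a ∷ b ∷ []) ((≢-sym b≢a , tt) , s≤s (s≤s z≤n)))

fullyInformed⇒I[] : ∀ {n} (I : InfoPersp n) → FullyInformed I → ∀ a w → Ag≥2 w → (I[ I ] a) w
fullyInformed⇒I[] I full a (x ∷ []) (_ , s≤s ())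
fullyInformed⇒I[] I full a (x ∷ y ∷ w) xyw∈Ag≥2@(noAdj , _) with x ≟ a
... | yes refl = inj₂ (full _ xyw∈Ag≥2 , y ∷ w , refl)
... | no x≢a   = inj₁ (xyw∈Ag≥2 , full _ ((≢-sym x≢a , noAdj) , s≤s (s≤s z≤n)))

module _ {n : ℕ} (G : CGS n) where

  ⊴-euclidean : ∀ (Z Z₁ Z' : State G) → FullyInformed (State.I Z) → ∀ a →
                _⊴[_]_ G Z a Z₁ → _⊴[_]_ G Z a Z' → _⊴[_]_ G Z₁ a Z'
  ⊴-euclidean (st χ I ρ) (st χ₁ I₁ ρ₁) (st χ' I' ρ') full a
              (χ∼χ₁ , _ , ρ∼ρ₁ , _ , Z₁-consistent)
              (χ∼χ' , I[a]⊆I' , ρ∼ρ' , _ , Z'-consistent) =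
      (λ b _ h → trans (sym (χ∼χ₁ b (everyAgent b) h)) (χ∼χ' b (everyAgent b) h))
    , (λ w w∈I₁[a] → I[a]⊆I' w (fullyInformed⇒I[] I full a w (I[]⊆Ag≥2 I₁ a w w∈I₁[a])))
    , ∼H-trans G (∼H-sym G ρ∼ρ₁) ρ∼ρ'
    , Z₁-consistent
    , Z'-consistent
    where
    everyAgent : ∀ b → I⟨ I ⟩ a b
    everyAgent = fullyInformed⇒I⟨⟩ I full a

  euclidean⇒negativeIntrospection :
    ∀ (Z : State G) a →
    (∀ Z₁ Z' → _⊴[_]_ G Z a Z₁ → _⊴[_]_ G Z a Z' → _⊴[_]_ G Z₁ a Z') →
    ∀ φ → _⊩_ G Z (¬f (K a φ) ⇒ K a (¬f (K a φ)))
  euclidean⇒negativeIntrospection Z a euclidean φ ¬Kφ Z₁ Z⊴Z₁ Z₁⊩Kφ =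
    ¬Kφ (λ Z' Z⊴Z' → Z₁⊩Kφ Z' (euclidean Z₁ Z' Z⊴Z₁ Z⊴Z'))

lemma7 : ∀ {n : ℕ} (G : CGS n) (Z : State G) → FullyInformed (State.I Z) →
           ∀ (a : Agent n) (φ : Form n) →
           _⊩_ G Z (¬f (K a φ) ⇒ K a (¬f (K a φ)))
lemma7 G Z full a =
  euclidean⇒negativeIntrospection G Z a (λ Z₁ Z' → ⊴-euclidean G Z Z₁ Z' full a)
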